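{- If $G$ is an odd cycle of diamonds, then $\operatorname{dal}(G)=\infty$, i.e. $G$ has no color-blind distinguishing edge-coloring with any finite number of colors.
   Context: A diamond is a subgraph consisting of two 3-cycles sharing an edge (vertices $x,y,z,w$ with edges $xy,xz,yz,yw,zw$). A cycle of diamonds is a 3-regular graph in which every vertex lies in a diamond; it is an odd cycle of diamonds if it has $4t$ vertices for an odd integer $t$ ($K_4$ counts as one). For an edge-coloring $c:E(G)\to\{1,\dots,k\}$ (not necessarily proper), let $\bar c(v)=(a_1,\dots,a_k)$ where $a_i$ is the number of edges at $v$ of color $i$, and $c^*(v)$ the nonincreasing rearrangement of $\bar c(v)$; $c$ is color-blind distinguishing if $c^*(u)\ne c^*(v)$ for every edge $uv$; $\operatorname{dal}(G)$ is the least such $k$, or $\infty$ if none exists. -}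

module Defs where

open import Data.Nat using (ℕ; zero; suc; _*_)
open import Data.Nat.Properties using (≤-decTotalOrder)
open import Data.Fin using (Fin; zero; suc)
open import Data.Fin.Properties using (_≟_)
open import Data.Bool using (Bool; true; false; if_then_else_)
open import Data.List using (List; reverse)
open import Data.Vec.Functional using (Vector; toList)
open import Data.Product using (Σ; ∃; _×_; _,_)
open import Relation.Binary.PropositionalEquality using (_≡_; _≢_)
open import Relation.Nullary using (¬_; Dec; yes; no)
import Data.List.Sort
open import Relation.Nullary.Decidable using (⌊_⌋)

countFin : ∀ {n} → (Fin n → Bool) → ℕ
countFin {zero}  p = 0
countFin {suc n} p = (if p zero then 1 else 0) + countFin (λ i → p (suc i))
  where open Data.Nat using (_+_)

record Graph (n : ℕ) : Set where
  field
    adj   : Fin n → Fin n → Bool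
    sym   : ∀ u v → adj u v ≡ adj v u
    irrefl : ∀ v → adj v v ≡ false
open Graph public

Adj : ∀ {n} → Graph n → Fin n → Fin n → Set
Adj G u v = adj G u v ≡ true

degree : ∀ {n} → Graph n → Fin n → ℕ
degree G v = countFin (adj G v)

Cubic : ∀ {n} → Graph n → Set
Cubic G = ∀ v → degree G v ≡ 3

IsDiamond : ∀ {n} → Graph n → Fin n → Fin n → Fin n → Fin n → Set
IsDiamond G x y z w =
  (x ≢ y × x ≢ z × x ≢ w × y ≢ z × y ≢ w × z ≢ w) ×
  (Adj G x y × Adj G x z × Adj G y z × Adj G y w × Adj G z w)

InDiamond : ∀ {n} → Graph n → Fin n → Set
InDiamond G v = ∃ λ x → ∃ λ y → ∃ λ z → ∃ λ w →
  IsDiamond G x y z w × (v ≡ x ⊎ v ≡ y ⊎ v ≡ z ⊎ v ≡ w)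
  where open import Data.Sum using (_⊎_)

CycleOfDiamonds : ∀ {n} → Graph n → Set
CycleOfDiamonds G = Cubic G × (∀ v → InDiamond G v)

Odd : ℕ → Set
Odd t = ∃ λ m → t ≡ suc (2 * m)

OddCycleOfDiamonds : ∀ {n} → Graph n → Set
OddCycleOfDiamonds {n} G = CycleOfDiamonds G × ∃ λ t → Odd t × n ≡ 4 * t

-- an edge colouring with k colours (not necessarily proper): a colour for each
-- ordered pair, required to agree on both orientations of every edge
-- (values on non-edges are irrelevant)
record EdgeColoring {n} (G : Graph n) (k : ℕ) : Set where
  field
    col    : Fin n → Fin n → Fin k
    col-sym : ∀ u v → Adj G u v → col u v ≡ col v u
open EdgeColoring public

cbar : ∀ {n k} {G : Graph n} → EdgeColoring G k → Fin n → Vector ℕ k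
cbar {G = G} c v i = countFin (λ u → adj G v u ∧ ⌊ col c v u ≟ i ⌋)
  where open Data.Bool using (_∧_)

open Data.List.Sort ≤-decTotalOrder using (sort)

cstar : ∀ {n k} {G : Graph n} → EdgeColoring G k → Fin n → List ℕ
cstar c v = reverse (sort (toList (cbar c v)))

ColorBlindDistinguishing : ∀ {n k} {G : Graph n} → EdgeColoring G k → Set
ColorBlindDistinguishing {G = G} c = ∀ u v → Adj G u v → cstar c u ≢ cstar c v

DalInfinite : ∀ {n} → Graph n → Set
DalInfinite G = ∀ k (c : EdgeColoring G k) → ¬ ColorBlindDistinguishing c

-- In a cubic graph the colour counts c̄(v) sum to 3, so c*(v) is one of (3), (2,1), (1,1,1):
-- call v mono, duo or rainbow. A colour-blind distinguishing colouring makes these shapes a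
-- proper 3-colouring. In a diamond x y z w, a mono end x would force the other end w to be
-- mono (the triangle y z w needs a mono vertex), and then y and z would see the same three
-- colours; so the ends are not mono and one middle vertex is. Exploiting how diamonds meet,
-- every non-mono vertex has exactly one mono neighbour, and every duo (rainbow) vertex exactly
-- two rainbow (duo) neighbours. Double counting gives 3·#mono = #duo + #rainbow and
-- #duo = #rainbow, so n = 4·#mono, #mono = t, and 3t = 2·#duo contradicts t odd.
module Submission where

open import Data.Bool using (Bool; true; false; not; _∧_; _∨_; if_then_else_) renaming (_≟_ to _≟ᵇ_)
open import Data.Bool.ListAction using (any)
open import Data.Bool.Properties
  using (∧-comm; ∧-assoc; ∧-identityʳ; ∧-zeroʳ; ∧-abs-∨; ∧-distribʳ-∨)
open import Data.Empty using (⊥; ⊥-elim)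
open import Data.Fin using (Fin; zero; suc; punchIn)
open import Data.Fin.Properties using (_≟_; any?)
open import Data.List as List using (List; []; _∷_; replicate; length; reverse)
open import Data.List.Properties using (tabulate-cong)
open import Data.List.Relation.Binary.Permutation.Propositional
  using (_↭_; ↭-refl; ↭-sym; ↭-trans; ↭-prep; ↭-swap; ↭-reflexive; ↭⇒↭ₛ′)
open import Data.List.Relation.Binary.Pointwise using (Pointwise-≡⇒≡)
open import Data.List.Relation.Unary.All using (All; []; _∷_)
open import Data.List.Relation.Unary.Sorted.TotalOrder.Properties using (↗↭↗⇒≋)
open import Data.Nat using (ℕ; zero; suc; _+_; _*_; _∸_; _≤_; _<_; z≤n; s≤s)
  renaming (_≟_ to _≟ℕ_)
import Data.Nat.ListAction as ℕ
open import Data.Nat.Properties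
  using (+-*-semiring; ≤-decTotalOrder; module ≤-Reasoning; ≤-refl; ≤-antisym; <⇒≱; ≤∧≢⇒<;
         m≤m+n; +-mono-≤; +-assoc; +-identityʳ; +-cancelˡ-≡; m+n≡0⇒m≡0; m+n≡0⇒n≡0; suc-injective;
         *-identityʳ; *-identityˡ; *-zeroʳ; *-cancelˡ-≡; even≢odd)
open import Data.Nat.Tactic.RingSolver using (solve-∀)
open import Data.Product using (∃; _×_; _,_; proj₁; proj₂)
open import Data.Sum using (_⊎_; inj₁; inj₂; [_,_])
open import Data.Unit using (⊤; tt)
open import Data.Vec.Functional using (Vector; toList; removeAt)
open import Function using (_∘_; id; flip; case_of_)
open import Relation.Binary.Bundles using (DecTotalOrder)
open import Relation.Binary.Definitions using (DecidableEquality)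
open import Relation.Binary.PropositionalEquality
  using (_≡_; _≢_; refl; sym; trans; cong; cong₂; subst; _≗_; isEquivalence; module ≡-Reasoning)
open import Relation.Nullary using (¬_; Dec; yes; no; does; contradiction)
open import Relation.Nullary.Decidable using (dec-true; dec-false; isYes≗does)
open import Defs renaming (sym to adj-sym)

open import Algebra.Properties.Semiring.Sum +-*-semiring
  using (sum; sum-remove; sum-cong-≗; ∑-comm; ∑-distrib-+; *-distribˡ-sum)
open import Data.List.Sort ≤-decTotalOrder using (sort; sort-↭; sort-↗)

dec-true⁻¹ : ∀ {A : Set} (a? : Dec A) → does a? ≡ true → A
dec-true⁻¹ (yes a) _ = a

𝟙 : Bool → ℕ
𝟙 b = if b then 1 else 0

countFin≡∑𝟙 : ∀ {n} (p : Fin n → Bool) → countFin p ≡ sum (𝟙 ∘ p)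
countFin≡∑𝟙 {zero}  p = refl
countFin≡∑𝟙 {suc n} p = cong (𝟙 (p zero) +_) (countFin≡∑𝟙 (p ∘ suc))

countFin-cong : ∀ {n} {p q : Fin n → Bool} → p ≗ q → countFin p ≡ countFin q
countFin-cong {zero}  p≗q = refl
countFin-cong {suc n} p≗q = cong₂ _+_ (cong 𝟙 (p≗q zero)) (countFin-cong (p≗q ∘ suc))

countFin-false : ∀ {n} → countFin {n} (λ _ → false) ≡ 0
countFin-false {zero}  = refl
countFin-false {suc n} = countFin-false {n}

countFin-true : ∀ {n} → countFin {n} (λ _ → true) ≡ n
countFin-true {zero}  = refl
countFin-true {suc n} = cong suc (countFin-true {n})

countFin-mono : ∀ {n} {p q : Fin n → Bool} → (∀ i → p i ≡ true → q i ≡ true) →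
  countFin p ≤ countFin q
countFin-mono {zero}      p⇒q = z≤n
countFin-mono {suc n}     p⇒q = +-mono-≤ (𝟙-mono (p⇒q zero)) (countFin-mono (p⇒q ∘ suc))
  where
  𝟙-mono : ∀ {a b} → (a ≡ true → b ≡ true) → 𝟙 a ≤ 𝟙 b
  𝟙-mono {false}         _   = z≤n
  𝟙-mono {true}  {true}  _   = ≤-refl
  𝟙-mono {true}  {false} a⇒b = contradiction (a⇒b refl) λ ()

countFin≡0 : ∀ {n} {p : Fin n → Bool} → countFin p ≡ 0 → ∀ i → p i ≡ false
countFin≡0 {suc n} {p} #p≡0 i with p zero in p₀
countFin≡0 {suc n} {p} #p≡0 zero    | false = p₀
countFin≡0 {suc n} {p} #p≡0 (suc i) | false = countFin≡0 #p≡0 i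

countFin-split : ∀ {n} (p q : Fin n → Bool) →
  countFin p ≡ countFin (λ i → p i ∧ q i) + countFin (λ i → p i ∧ not (q i))
countFin-split p q = begin
  countFin p                          ≡⟨ countFin≡∑𝟙 p ⟩
  sum (𝟙 ∘ p)                         ≡⟨ sum-cong-≗ (λ i → 𝟙-split (p i) (q i)) ⟩
  sum (λ i → 𝟙 (p∧q i) + 𝟙 (p∧¬q i))  ≡⟨ ∑-distrib-+ (𝟙 ∘ p∧q) (𝟙 ∘ p∧¬q) ⟩
  sum (𝟙 ∘ p∧q) + sum (𝟙 ∘ p∧¬q)      ≡⟨ cong₂ _+_ (countFin≡∑𝟙 p∧q) (countFin≡∑𝟙 p∧¬q) ⟨
  countFin p∧q + countFin p∧¬q        ∎
  where
  open ≡-Reasoning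
  p∧q p∧¬q : Fin _ → Bool
  p∧q  i = p i ∧ q i
  p∧¬q i = p i ∧ not (q i)
  𝟙-split : ∀ a b → 𝟙 a ≡ 𝟙 (a ∧ b) + 𝟙 (a ∧ not b)
  𝟙-split false _     = refl
  𝟙-split true  false = refl
  𝟙-split true  true  = refl

countFin-∧-congʳ : ∀ {n} {p q r : Fin n → Bool} → (∀ i → p i ≡ true → q i ≡ r i) →
  countFin (λ i → p i ∧ q i) ≡ countFin (λ i → p i ∧ r i)
countFin-∧-congʳ {p = p} {q} {r} q≡r = countFin-cong pointwise
  where
  pointwise : ∀ i → p i ∧ q i ≡ p i ∧ r i
  pointwise i with p i in pᵢ
  ... | false = refl
  ... | true  = q≡r i pᵢ

countFin-∧-saturated : ∀ {n} {p q : Fin n → Bool} → countFin (λ i → p i ∧ q i) ≡ countFin p →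
  ∀ i → p i ≡ true → q i ≡ true
countFin-∧-saturated {p = p} {q} #p∧q≡#p i pᵢ =
  not-false (subst (λ b → b ∧ not (q i) ≡ false) pᵢ (countFin≡0 #p∧¬q≡0 i))
  where
  #p∧¬q≡0 : countFin (λ i → p i ∧ not (q i)) ≡ 0
  #p∧¬q≡0 = +-cancelˡ-≡ _ _ 0
    (trans (sym (countFin-split p q)) (trans (sym #p∧q≡#p) (sym (+-identityʳ _))))
  not-false : ∀ {b} → not b ≡ false → b ≡ true
  not-false {true} _ = refl

countFin-point : ∀ {n} (x : Fin n) (q : Fin n → Bool) →
  countFin (λ i → does (x ≟ i) ∧ q i) ≡ 𝟙 (q x)
countFin-point {suc n} zero    q = trans (cong (𝟙 (q zero) +_) (countFin-false {n})) (+-identityʳ _)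
countFin-point {suc n} (suc x) q = countFin-point x (q ∘ suc)

∑-countFin-fibres : ∀ {n k} (p : Fin n → Bool) (f : Fin n → Fin k) →
  sum (λ i → countFin (λ u → p u ∧ does (f u ≟ i))) ≡ countFin p
∑-countFin-fibres p f = begin
  sum (λ i → countFin (flip in-fibre i))     ≡⟨ sum-cong-≗ (countFin≡∑𝟙 ∘ flip in-fibre) ⟩
  sum (λ i → sum (λ u → 𝟙 (in-fibre u i)))   ≡⟨ ∑-comm (λ i u → 𝟙 (in-fibre u i)) ⟩
  sum (λ u → sum (λ i → 𝟙 (in-fibre u i)))   ≡⟨ sum-cong-≗ fibre ⟩
  sum (𝟙 ∘ p)                                 ≡⟨ countFin≡∑𝟙 p ⟨
  countFin p                                  ∎
  where
  open ≡-Reasoning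
  in-fibre : Fin _ → Fin _ → Bool
  in-fibre u i = p u ∧ does (f u ≟ i)
  fibre : ∀ u → sum (λ i → 𝟙 (in-fibre u i)) ≡ 𝟙 (p u)
  fibre u = begin
    sum (λ i → 𝟙 (in-fibre u i))           ≡⟨ countFin≡∑𝟙 (in-fibre u) ⟨
    countFin (in-fibre u)                  ≡⟨ countFin-cong (λ i → ∧-comm (p u) (does (f u ≟ i))) ⟩
    countFin (λ i → does (f u ≟ i) ∧ p u)  ≡⟨ countFin-point (f u) (λ _ → p u) ⟩
    𝟙 (p u)                                ∎

countFin-∨ : ∀ {n} (a b : Fin n → Bool) → (∀ i → a i ∧ b i ≡ false) →
  countFin (λ i → a i ∨ b i) ≡ countFin a + countFin b
countFin-∨ a b disjoint = begin
  countFin (λ i → a i ∨ b i)                                              ≡⟨ countFin-split _ a ⟩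
  countFin (λ i → (a i ∨ b i) ∧ a i) + countFin (λ i → (a i ∨ b i) ∧ not (a i))
    ≡⟨ cong₂ _+_ (countFin-cong λ i → trans (∧-comm (a i ∨ b i) (a i)) (∧-abs-∨ (a i) (b i)))
                 (countFin-cong λ i → other (a i) (b i) (disjoint i)) ⟩
  countFin a + countFin b                                                 ∎
  where
  open ≡-Reasoning
  other : ∀ a b → a ∧ b ≡ false → (a ∨ b) ∧ not a ≡ b
  other false b     _ = ∧-identityʳ b
  other true  false _ = refl

_∈ᵇ_ : ∀ {n} → Fin n → List (Fin n) → Bool
u ∈ᵇ xs = any (λ x → does (x ≟ u)) xs

Distinct : ∀ {n} → List (Fin n) → Set
Distinct []       = ⊤
Distinct (x ∷ xs) = x ∈ᵇ xs ≡ false × Distinct xs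

∈ᵇ-All : ∀ {n} {P : Fin n → Set} {xs} → All P xs → ∀ u → u ∈ᵇ xs ≡ true → P u
∈ᵇ-All (_∷_ {x = x} Px Pxs) u u∈x∷xs with x ≟ u
... | yes refl = Px
... | no  _    = ∈ᵇ-All Pxs u u∈x∷xs

countFin-∈ᵇ-∧ : ∀ {n} (xs : List (Fin n)) → Distinct xs → (q : Fin n → Bool) →
  countFin (λ u → u ∈ᵇ xs ∧ q u) ≡ ℕ.sum (List.map (𝟙 ∘ q) xs)
countFin-∈ᵇ-∧ {n} []       _              q = countFin-false {n}
countFin-∈ᵇ-∧     (x ∷ xs) (x∉xs , xs-distinct) q = begin
  countFin (λ u → (does (x ≟ u) ∨ u ∈ᵇ xs) ∧ q u)
    ≡⟨ countFin-cong (λ u → ∧-distribʳ-∨ (q u) (does (x ≟ u)) (u ∈ᵇ xs)) ⟩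
  countFin (λ u → (does (x ≟ u) ∧ q u) ∨ (u ∈ᵇ xs ∧ q u))
    ≡⟨ countFin-∨ _ _ disjoint ⟩
  countFin (λ u → does (x ≟ u) ∧ q u) + countFin (λ u → u ∈ᵇ xs ∧ q u)
    ≡⟨ cong₂ _+_ (countFin-point x q) (countFin-∈ᵇ-∧ xs xs-distinct q) ⟩
  𝟙 (q x) + ℕ.sum (List.map (𝟙 ∘ q) xs) ∎
  where
  open ≡-Reasoning
  disjoint : ∀ u → (does (x ≟ u) ∧ q u) ∧ (u ∈ᵇ xs ∧ q u) ≡ false
  disjoint u with x ≟ u
  ... | no  _    = refl
  ... | yes refl rewrite x∉xs = ∧-zeroʳ (q x)

countFin-∈ᵇ : ∀ {n} (xs : List (Fin n)) → Distinct xs → countFin (_∈ᵇ xs) ≡ length xs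
countFin-∈ᵇ xs xs-distinct = begin
  countFin (_∈ᵇ xs)                ≡⟨ countFin-cong (λ u → sym (∧-identityʳ (u ∈ᵇ xs))) ⟩
  countFin (λ u → u ∈ᵇ xs ∧ true)  ≡⟨ countFin-∈ᵇ-∧ xs xs-distinct (λ _ → true) ⟩
  ℕ.sum (List.map (λ _ → 1) xs)    ≡⟨ sum-ones xs ⟩
  length xs                        ∎
  where
  open ≡-Reasoning
  sum-ones : ∀ {A : Set} (ys : List A) → ℕ.sum (List.map (λ _ → 1) ys) ≡ length ys
  sum-ones []       = refl
  sum-ones (_ ∷ ys) = cong suc (sum-ones ys)

≗-∈ᵇ : ∀ {n} {p : Fin n → Bool} {xs} → Distinct xs → All (λ x → p x ≡ true) xs →
  countFin p ≡ length xs → p ≗ (_∈ᵇ xs)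
≗-∈ᵇ {p = p} {xs} xs-distinct p-on-xs #p≡|xs| u with u ∈ᵇ xs in u∈xs | p u in pᵤ
... | true  | true  = refl
... | false | false = refl
... | true  | false = contradiction (trans (sym (∈ᵇ-All p-on-xs u u∈xs)) pᵤ) λ ()
... | false | true  = ⊥-elim (<⇒≱ ≤-refl (begin
  suc (length xs)    ≡⟨ countFin-∈ᵇ (u ∷ xs) (u∈xs , xs-distinct) ⟨
  countFin (_∈ᵇ (u ∷ xs)) ≤⟨ countFin-mono (∈ᵇ-All (pᵤ ∷ p-on-xs)) ⟩
  countFin p         ≡⟨ #p≡|xs| ⟩
  length xs          ∎))
  where open ≤-Reasoning

∃-∉ᵇ : ∀ {n} {p : Fin n → Bool} (xs : List (Fin n)) → Distinct xs → length xs < countFin p →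
  ∃ λ u → p u ≡ true × u ∈ᵇ xs ≡ false
∃-∉ᵇ {p = p} xs xs-distinct |xs|<#p with any? (λ u → p u ∧ not (u ∈ᵇ xs) ≟ᵇ true)
... | yes (u , pᵤ∧u∉xs) = u , ∧-true (pᵤ∧u∉xs) .proj₁ , ∧-true pᵤ∧u∉xs .proj₂
  where
  ∧-true : ∀ {a b} → a ∧ not b ≡ true → a ≡ true × b ≡ false
  ∧-true {true} {false} _ = refl , refl
... | no ¬∃ = ⊥-elim (<⇒≱ |xs|<#p (begin
  countFin p         ≤⟨ countFin-mono p⇒∈ ⟩
  countFin (_∈ᵇ xs)  ≡⟨ countFin-∈ᵇ xs xs-distinct ⟩
  length xs          ∎))
  where
  open ≤-Reasoning
  p⇒∈ : ∀ u → p u ≡ true → u ∈ᵇ xs ≡ true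
  p⇒∈ u pᵤ with u ∈ᵇ xs in u∈xs
  ... | true  = refl
  ... | false = contradiction (u , cong₂ (λ a b → a ∧ not b) pᵤ u∈xs) ¬∃

∉ᵇ⇒All≢ : ∀ {n} {u : Fin n} xs → u ∈ᵇ xs ≡ false → All (_≢ u) xs
∉ᵇ⇒All≢         []       _      = []
∉ᵇ⇒All≢ {u = u} (x ∷ xs) u∉x∷xs with x ≟ u
... | no x≢u = x≢u ∷ ∉ᵇ⇒All≢ xs u∉x∷xs

distinct₂ : ∀ {n} {p q : Fin n} → p ≢ q → Distinct (p ∷ q ∷ [])
distinct₂ {q = q} p≢q = cong (_∨ false) (dec-false (q ≟ _) (p≢q ∘ sym)) , refl , tt

distinct₃ : ∀ {n} {p q r : Fin n} → p ≢ q → p ≢ r → q ≢ r → Distinct (p ∷ q ∷ r ∷ [])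
distinct₃ {q = q} {r} p≢q p≢r q≢r =
  cong₂ _∨_ (dec-false (q ≟ _) (p≢q ∘ sym)) (proj₁ (distinct₂ p≢r)) , distinct₂ q≢r

data Shape : Set where
  mono duo rainbow : Shape

_≟ₛ_ : DecidableEquality Shape
mono    ≟ₛ mono    = yes refl
mono    ≟ₛ duo     = no λ ()
mono    ≟ₛ rainbow = no λ ()
duo     ≟ₛ mono    = no λ ()
duo     ≟ₛ duo     = yes refl
duo     ≟ₛ rainbow = no λ ()
rainbow ≟ₛ mono    = no λ ()
rainbow ≟ₛ duo     = no λ ()
rainbow ≟ₛ rainbow = yes refl

triangle-mono : ∀ {a b c} → a ≢ b → a ≢ c → b ≢ c → a ≡ mono ⊎ b ≡ mono ⊎ c ≡ mono
triangle-mono {mono}                   _   _   _   = inj₁ refl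
triangle-mono {_}       {mono}         _   _   _   = inj₂ (inj₁ refl)
triangle-mono {_}       {_}    {mono}  _   _   _   = inj₂ (inj₂ refl)
triangle-mono {duo}     {duo}          a≢b _   _   = contradiction refl a≢b
triangle-mono {rainbow} {rainbow}      a≢b _   _   = contradiction refl a≢b
triangle-mono {duo}     {rainbow} {duo}     _ a≢c _   = contradiction refl a≢c
triangle-mono {duo}     {rainbow} {rainbow} _ _   b≢c = contradiction refl b≢c
triangle-mono {rainbow} {duo}     {duo}     _ _   b≢c = contradiction refl b≢c
triangle-mono {rainbow} {duo}     {rainbow} _ a≢c _   = contradiction refl a≢c

rainbow⇔non-mono : ∀ s → s ≢ duo → does (s ≟ₛ rainbow) ≡ not (does (s ≟ₛ mono))
rainbow⇔non-mono mono    _     = refl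
rainbow⇔non-mono duo     s≢duo = contradiction refl s≢duo
rainbow⇔non-mono rainbow _     = refl

duo⇔non-mono : ∀ s → s ≢ rainbow → does (s ≟ₛ duo) ≡ not (does (s ≟ₛ mono))
duo⇔non-mono mono    _         = refl
duo⇔non-mono duo     _         = refl
duo⇔non-mono rainbow s≢rainbow = contradiction refl s≢rainbow

non-mono∧duo : ∀ s → not (does (s ≟ₛ mono)) ∧ does (s ≟ₛ duo) ≡ does (s ≟ₛ duo)
non-mono∧duo mono    = refl
non-mono∧duo duo     = refl
non-mono∧duo rainbow = refl

non-mono∧non-duo : ∀ s →
  not (does (s ≟ₛ mono)) ∧ not (does (s ≟ₛ duo)) ≡ does (s ≟ₛ rainbow)
non-mono∧non-duo mono    = refl
non-mono∧non-duo duo     = refl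
non-mono∧non-duo rainbow = refl

shape : ∀ {k} → Vector ℕ k → Shape
shape f with any? (λ i → f i ≟ℕ 3)
... | yes _ = mono
... | no  _ with any? (λ i → f i ≟ℕ 2)
...   | yes _ = duo
...   | no  _ = rainbow

shape-mono : ∀ {k} (f : Vector ℕ k) → shape f ≡ mono → ∃ λ i → f i ≡ 3
shape-mono f _ with any? (λ i → f i ≟ℕ 3)
... | yes ∃fi≡3 = ∃fi≡3
... | no  _ with any? (λ i → f i ≟ℕ 2)
shape-mono f () | no _ | yes _
shape-mono f () | no _ | no  _

shapeList : ℕ → Shape → List ℕ
shapeList k mono    = 3 ∷ replicate (k ∸ 1) 0
shapeList k duo     = 2 ∷ 1 ∷ replicate (k ∸ 2) 0
shapeList k rainbow = 1 ∷ 1 ∷ 1 ∷ replicate (k ∸ 3) 0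

≤-sum : ∀ {k} (f : Vector ℕ k) i → f i ≤ sum f
≤-sum {suc k} f i = subst (f i ≤_) (sym (sum-remove {i = i} f)) (m≤m+n (f i) _)

sum-pos : ∀ {k} (f : Vector ℕ k) → 0 < sum f → ∃ λ i → 0 < f i
sum-pos {suc k} f pos with f zero in f₀
... | suc _ = zero , subst (0 <_) (sym f₀) (s≤s z≤n)
... | zero  = let i , 0<fᵢ = sum-pos (f ∘ suc) pos in suc i , 0<fᵢ

toList-sum≡0 : ∀ {k} (f : Vector ℕ k) → sum f ≡ 0 → toList f ≡ replicate k 0
toList-sum≡0 {zero}  f _    = refl
toList-sum≡0 {suc k} f ∑f≡0 =
  cong₂ _∷_ (m+n≡0⇒m≡0 (f zero) ∑f≡0) (toList-sum≡0 (f ∘ suc) (m+n≡0⇒n≡0 (f zero) ∑f≡0))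

toList-removeAt : ∀ {k} (f : Vector ℕ (suc k)) i {m} → f i ≡ m →
  toList f ↭ m ∷ toList (removeAt f i)
toList-removeAt f zero refl = ↭-refl
toList-removeAt {suc k} f (suc i) refl =
  ↭-trans (↭-prep (f zero) (toList-removeAt (f ∘ suc) i refl)) (↭-swap (f zero) (f (suc i)) ↭-refl)

↭-∷-removeAt : ∀ {k} (f : Vector ℕ (suc k)) i {m s ys} → f i ≡ m → sum f ≡ m + s →
  (sum (removeAt f i) ≡ s → toList (removeAt f i) ↭ ys) → toList f ↭ m ∷ ys
↭-∷-removeAt f i {m} {s} fᵢ≡m ∑f≡m+s arrange-rest =
  ↭-trans (toList-removeAt f i fᵢ≡m) (↭-prep m (arrange-rest ∑rest≡s))
  where
  ∑rest≡s : sum (removeAt f i) ≡ s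
  ∑rest≡s = +-cancelˡ-≡ m _ _
    (trans (subst (λ x → x + _ ≡ sum f) fᵢ≡m (sym (sum-remove {i = i} f))) ∑f≡m+s)

entry≡1 : ∀ {m} → 0 < m → m < 3 → m ≢ 2 → m ≡ 1
entry≡1 {1}                 _ _                         _   = refl
entry≡1 {2}                 _ _                         m≢2 = contradiction refl m≢2
entry≡1 {suc (suc (suc _))} _ (s≤s (s≤s (s≤s ())))

toList-sum≡1 : ∀ {k} (f : Vector ℕ k) → sum f ≡ 1 → toList f ↭ 1 ∷ replicate (k ∸ 1) 0
toList-sum≡1 {suc k} f ∑f≡1 =
  let i , 0<fᵢ = sum-pos f (subst (0 <_) (sym ∑f≡1) (s≤s z≤n))
      fᵢ≡1     = ≤-antisym (subst (f i ≤_) ∑f≡1 (≤-sum f i)) 0<fᵢ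
  in ↭-∷-removeAt f i fᵢ≡1 ∑f≡1 (↭-reflexive ∘ toList-sum≡0 (removeAt f i))

toList-sum≡2 : ∀ {k} (f : Vector ℕ k) → (∀ i → f i ≢ 2) → sum f ≡ 2 →
  toList f ↭ 1 ∷ 1 ∷ replicate (k ∸ 2) 0
toList-sum≡2 {suc k} f no-2 ∑f≡2 =
  let i , 0<fᵢ = sum-pos f (subst (0 <_) (sym ∑f≡2) (s≤s z≤n))
      fᵢ≡1     = entry≡1 0<fᵢ (s≤s (subst (f i ≤_) ∑f≡2 (≤-sum f i))) (no-2 i)
  in ↭-∷-removeAt f i fᵢ≡1 ∑f≡2 (toList-sum≡1 (removeAt f i))

toList-shape : ∀ {k} (f : Vector ℕ k) → sum f ≡ 3 → toList f ↭ shapeList k (shape f)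
toList-shape {suc k} f ∑f≡3 with any? (λ i → f i ≟ℕ 3)
... | yes (i , fᵢ≡3) = ↭-∷-removeAt f i fᵢ≡3 ∑f≡3 (↭-reflexive ∘ toList-sum≡0 (removeAt f i))
... | no  no-3 with any? (λ i → f i ≟ℕ 2)
...   | yes (i , fᵢ≡2) = ↭-∷-removeAt f i fᵢ≡2 ∑f≡3 (toList-sum≡1 (removeAt f i))
...   | no  no-2 =
  let i , 0<fᵢ = sum-pos f (subst (0 <_) (sym ∑f≡3) (s≤s z≤n))
      fᵢ<3     = ≤∧≢⇒< (subst (f i ≤_) ∑f≡3 (≤-sum f i)) (λ fᵢ≡3 → no-3 (i , fᵢ≡3))
      fᵢ≡1     = entry≡1 0<fᵢ fᵢ<3 (λ fᵢ≡2 → no-2 (i , fᵢ≡2))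
  in ↭-∷-removeAt f i fᵢ≡1 ∑f≡3
       (toList-sum≡2 (removeAt f i) (λ j fⱼ≡2 → no-2 (punchIn i j , fⱼ≡2)))

sort-↭-≡ : ∀ {xs ys : List ℕ} → xs ↭ ys → sort xs ≡ sort ys
sort-↭-≡ {xs} {ys} xs↭ys =
  Pointwise-≡⇒≡ (↗↭↗⇒≋ (DecTotalOrder.totalOrder ≤-decTotalOrder) (sort-↗ xs) (sort-↗ ys)
    (↭⇒↭ₛ′ isEquivalence (↭-trans (sort-↭ xs) (↭-trans xs↭ys (↭-sym (sort-↭ ys))))))

pattern diamond x≢y x≢z x≢w y≢z y≢w z≢w xy xz yz yw zw =
  (x≢y , x≢z , x≢w , y≢z , y≢w , z≢w) , (xy , xz , yz , yw , zw)

module GraphProperties {n : ℕ} (G : Graph n) where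

  Adj-sym : ∀ {u v} → Adj G u v → Adj G v u
  Adj-sym {u} {v} uv = trans (adj-sym G v u) uv

  Adj⇒≢ : ∀ {u v} → Adj G u v → u ≢ v
  Adj⇒≢ {u} uu refl = contradiction (trans (sym uu) (irrefl G u)) λ ()

  Neighbours : Fin n → Fin n → Fin n → Fin n → Set
  Neighbours v p q r = (p ≢ q × p ≢ r × q ≢ r) × (Adj G v p × Adj G v q × Adj G v r)

  edge : (Fin n → Bool) → (Fin n → Bool) → Fin n → Fin n → Bool
  edge P Q u v = (P u ∧ adj G u v) ∧ Q v

  edgesBetween : (Fin n → Bool) → (Fin n → Bool) → ℕ
  edgesBetween P Q = sum (λ u → countFin (edge P Q u))

  edgesBetween-comm : ∀ P Q → edgesBetween P Q ≡ edgesBetween Q P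
  edgesBetween-comm P Q = begin
    sum (λ u → countFin (edge P Q u))         ≡⟨ sum-cong-≗ (countFin≡∑𝟙 ∘ edge P Q) ⟩
    sum (λ u → sum (λ v → 𝟙 (edge P Q u v)))  ≡⟨ ∑-comm (λ u v → 𝟙 (edge P Q u v)) ⟩
    sum (λ v → sum (λ u → 𝟙 (edge P Q u v)))  ≡⟨ sum-cong-≗ (λ v → sum-cong-≗ λ u → cong 𝟙 (reorder u v)) ⟩
    sum (λ v → sum (λ u → 𝟙 (edge Q P v u)))  ≡⟨ sum-cong-≗ (countFin≡∑𝟙 ∘ edge Q P) ⟨
    sum (λ v → countFin (edge Q P v))         ∎
    where
    open ≡-Reasoning
    reorder : ∀ u v → edge P Q u v ≡ edge Q P v u
    reorder u v = begin
      (P u ∧ adj G u v) ∧ Q v   ≡⟨ ∧-comm _ (Q v) ⟩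
      Q v ∧ (P u ∧ adj G u v)   ≡⟨ cong (Q v ∧_) (∧-comm (P u) _) ⟩
      Q v ∧ (adj G u v ∧ P u)   ≡⟨ cong (λ b → Q v ∧ (b ∧ P u)) (adj-sym G u v) ⟩
      Q v ∧ (adj G v u ∧ P u)   ≡⟨ ∧-assoc (Q v) _ _ ⟨
      (Q v ∧ adj G v u) ∧ P u   ∎

  edgesBetween-regular : ∀ P Q m →
    (∀ u → P u ≡ true → countFin (λ v → adj G u v ∧ Q v) ≡ m) → edgesBetween P Q ≡ m * countFin P
  edgesBetween-regular P Q m regular = begin
    sum (λ u → countFin (edge P Q u))  ≡⟨ sum-cong-≗ row ⟩
    sum (λ u → m * 𝟙 (P u))            ≡⟨ *-distribˡ-sum m (𝟙 ∘ P) ⟨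
    m * sum (𝟙 ∘ P)                    ≡⟨ cong (m *_) (countFin≡∑𝟙 P) ⟨
    m * countFin P                     ∎
    where
    open ≡-Reasoning
    row : ∀ u → countFin (edge P Q u) ≡ m * 𝟙 (P u)
    row u with P u in Pᵤ
    ... | true  = trans (regular u Pᵤ) (sym (*-identityʳ m))
    ... | false = trans (countFin-false {n}) (sym (*-zeroʳ m))

  double-counting : ∀ P Q {m m′} →
    (∀ u → P u ≡ true → countFin (λ v → adj G u v ∧ Q v) ≡ m) →
    (∀ v → Q v ≡ true → countFin (λ u → adj G v u ∧ P u) ≡ m′) →
    m * countFin P ≡ m′ * countFin Q
  double-counting P Q {m} {m′} P-regular Q-regular = begin
    m * countFin P     ≡⟨ edgesBetween-regular P Q m P-regular ⟨
    edgesBetween P Q   ≡⟨ edgesBetween-comm P Q ⟩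
    edgesBetween Q P   ≡⟨ edgesBetween-regular Q P m′ Q-regular ⟩
    m′ * countFin Q    ∎
    where open ≡-Reasoning

  neighbours-swap : ∀ {v p q r} → Neighbours v p q r → Neighbours v q p r
  neighbours-swap ((p≢q , p≢r , q≢r) , (vp , vq , vr)) =
    ((p≢q ∘ sym) , q≢r , p≢r) , (vq , vp , vr)

  diamond-swap : ∀ {x y z w} → IsDiamond G x y z w → IsDiamond G x z y w
  diamond-swap (diamond x≢y x≢z x≢w y≢z y≢w z≢w xy xz yz yw zw) =
    diamond x≢z x≢y x≢w (y≢z ∘ sym) z≢w y≢w xz xy (Adj-sym yz) zw yw

  diamond-reverse : ∀ {x y z w} → IsDiamond G x y z w → IsDiamond G w y z x
  diamond-reverse (diamond x≢y x≢z x≢w y≢z y≢w z≢w xy xz yz yw zw) =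
    diamond (y≢w ∘ sym) (z≢w ∘ sym) (x≢w ∘ sym) y≢z (x≢y ∘ sym) (x≢z ∘ sym)
            (Adj-sym yw) (Adj-sym zw) yz (Adj-sym xy) (Adj-sym xz)

  diamond-middle : ∀ {x y z w} → IsDiamond G x y z w → Neighbours y x z w
  diamond-middle (diamond _ x≢z x≢w _ _ z≢w xy _ yz yw _) =
    (x≢z , x≢w , z≢w) , (Adj-sym xy , yz , yw)

module CubicProperties {n : ℕ} {G : Graph n} (cubic : Cubic G) where

  open GraphProperties G

  neighbours-≗ : ∀ {v p q r} → Neighbours v p q r → adj G v ≗ (_∈ᵇ (p ∷ q ∷ r ∷ []))
  neighbours-≗ {v} ((p≢q , p≢r , q≢r) , (vp , vq , vr)) =
    ≗-∈ᵇ (distinct₃ p≢q p≢r q≢r) (vp ∷ vq ∷ vr ∷ []) (cubic v)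

  neighbour-cases : ∀ {v p q r u} → Neighbours v p q r → Adj G v u → u ≡ p ⊎ u ≡ q ⊎ u ≡ r
  neighbour-cases {p = p} {q} {r} {u} N vu =
    ∈ᵇ-All {P = λ u → u ≡ p ⊎ u ≡ q ⊎ u ≡ r}
      (inj₁ refl ∷ inj₂ (inj₁ refl) ∷ inj₂ (inj₂ refl) ∷ []) u (trans (sym (neighbours-≗ N u)) vu)

  countFin-neighbours : ∀ {v p q r} → Neighbours v p q r → (Q : Fin n → Bool) →
    countFin (λ u → adj G v u ∧ Q u) ≡ ℕ.sum (List.map (𝟙 ∘ Q) (p ∷ q ∷ r ∷ []))
  countFin-neighbours N@((p≢q , p≢r , q≢r) , _) Q =
    trans (countFin-cong λ u → cong (_∧ Q u) (neighbours-≗ N u))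
          (countFin-∈ᵇ-∧ _ (distinct₃ p≢q p≢r q≢r) Q)

  third-neighbour : ∀ {v p q} → p ≢ q → Adj G v p → Adj G v q → ∃ λ r → Neighbours v p q r
  third-neighbour {v} {p} {q} p≢q vp vq =
    let r , vr , r∉pq =
          ∃-∉ᵇ (p ∷ q ∷ []) (distinct₂ p≢q) (subst (2 <_) (sym (cubic v)) ≤-refl)
    in  case ∉ᵇ⇒All≢ (p ∷ q ∷ []) r∉pq of λ where
          (p≢r ∷ q≢r ∷ []) → r , (p≢q , p≢r , q≢r) , (vp , vq , vr)

module Colouring {n : ℕ} {G : Graph n} (cubic : Cubic G) {k : ℕ} (c : EdgeColoring G k)
                 (distinguishing : ColorBlindDistinguishing c) where

  open GraphProperties G
  open CubicProperties {G = G} cubic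

  shapeAt : Fin n → Shape
  shapeAt v = shape (cbar c v)

  -- cbar uses ⌊_⌋ (isYes), which, unlike does, does not compute through Fin's _≟_.
  cbar-does : ∀ v i → cbar c v i ≡ countFin (λ u → adj G v u ∧ does (col c v u ≟ i))
  cbar-does v i = countFin-cong (λ u → cong (adj G v u ∧_) (isYes≗does (col c v u ≟ i)))

  sum-cbar : ∀ v → sum (cbar c v) ≡ 3
  sum-cbar v = trans (sum-cong-≗ (cbar-does v)) (trans (∑-countFin-fibres (adj G v) (col c v)) (cubic v))

  shapeAt-proper : ∀ {u v} → Adj G u v → shapeAt u ≢ shapeAt v
  shapeAt-proper {u} {v} uv same-shape = distinguishing u v uv (cong reverse (sort-↭-≡ arrangement))
    where
    arrangement : toList (cbar c u) ↭ toList (cbar c v)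
    arrangement = ↭-trans (toList-shape (cbar c u) (sum-cbar u))
                 (↭-trans (↭-reflexive (cong (shapeList k) same-shape))
                          (↭-sym (toList-shape (cbar c v) (sum-cbar v))))

  mono-edges-agree : ∀ {v u u′} → shapeAt v ≡ mono → Adj G v u → Adj G v u′ →
    col c u v ≡ col c u′ v
  mono-edges-agree {v} {u} {u′} v-mono vu vu′ =
    trans (sym (col-sym c v u vu)) (trans (star u vu) (trans (sym (star u′ vu′)) (col-sym c v u′ vu′)))
    where
    a : Fin k
    a = proj₁ (shape-mono (cbar c v) v-mono)
    #a≡degree : countFin (λ t → adj G v t ∧ does (col c v t ≟ a)) ≡ countFin (adj G v)
    #a≡degree = trans (sym (cbar-does v a))
                      (trans (proj₂ (shape-mono (cbar c v) v-mono)) (sym (cubic v)))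
    star : ∀ t → Adj G v t → col c v t ≡ a
    star t vt = dec-true⁻¹ (col c v t ≟ a) (countFin-∧-saturated #a≡degree t vt)

  colourCount : List (Fin k) → Fin k → ℕ
  colourCount as i = ℕ.sum (List.map (λ a → 𝟙 (does (a ≟ i))) as)

  cbar-neighbours : ∀ {v p q r} → Neighbours v p q r → ∀ i →
    cbar c v i ≡ colourCount (col c v p ∷ col c v q ∷ col c v r ∷ []) i
  cbar-neighbours {v} N i = trans (cbar-does v i) (countFin-neighbours N (λ u → does (col c v u ≟ i)))

  triangle-has-mono : ∀ {u v w} → Adj G u v → Adj G u w → Adj G v w →
    shapeAt u ≡ mono ⊎ shapeAt v ≡ mono ⊎ shapeAt w ≡ mono
  triangle-has-mono uv uw vw = triangle-mono (shapeAt-proper uv) (shapeAt-proper uw) (shapeAt-proper vw)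

  diamond-ends-not-both-mono : ∀ {x y z w} → IsDiamond G x y z w →
    shapeAt x ≡ mono → shapeAt w ≡ mono → ⊥
  diamond-ends-not-both-mono {x} {y} {z} {w} d@(diamond _ _ _ _ _ _ xy xz yz yw zw) x-mono w-mono =
    distinguishing y z yz (cong (reverse ∘ sort) (tabulate-cong same-counts))
    where
    same-colours : col c y x ∷ col c y z ∷ col c y w ∷ [] ≡ col c z x ∷ col c z y ∷ col c z w ∷ []
    same-colours = cong₂ _∷_ (mono-edges-agree x-mono xy xz)
                  (cong₂ _∷_ (col-sym c y z yz)
                  (cong (_∷ []) (mono-edges-agree w-mono (Adj-sym yw) (Adj-sym zw))))
    same-counts : cbar c y ≗ cbar c z
    same-counts i = trans (cbar-neighbours (diamond-middle d) i)
                   (trans (cong (flip colourCount i) same-colours)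
                          (sym (cbar-neighbours (diamond-middle (diamond-swap d)) i)))

  diamond-end-not-mono : ∀ {x y z w} → IsDiamond G x y z w → shapeAt x ≢ mono
  diamond-end-not-mono {x} {y} {z} {w} d@(diamond _ _ _ _ _ _ xy xz yz yw zw) x-mono =
    [ y-not-mono , [ z-not-mono , w-not-mono ] ] (triangle-has-mono yz yw zw)
    where
    y-not-mono : shapeAt y ≢ mono
    y-not-mono y-mono = shapeAt-proper xy (trans x-mono (sym y-mono))
    z-not-mono : shapeAt z ≢ mono
    z-not-mono z-mono = shapeAt-proper xz (trans x-mono (sym z-mono))
    w-not-mono : shapeAt w ≢ mono
    w-not-mono = diamond-ends-not-both-mono d x-mono

  diamond-middle-mono : ∀ {x y z w} → IsDiamond G x y z w → shapeAt y ≡ mono ⊎ shapeAt z ≡ mono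
  diamond-middle-mono d@(diamond _ _ _ _ _ _ xy xz yz _ _) =
    [ (λ x-mono → contradiction x-mono (diamond-end-not-mono d)) , id ] (triangle-has-mono xy xz yz)

  has : Shape → Fin n → Bool
  has s u = does (shapeAt u ≟ₛ s)

  𝟙-has : ∀ {s u} → shapeAt u ≡ s → 𝟙 (has s u) ≡ 1
  𝟙-has {s} {u} u-s = cong 𝟙 (dec-true (shapeAt u ≟ₛ s) u-s)

  𝟙-has-not : ∀ {s u} → shapeAt u ≢ s → 𝟙 (has s u) ≡ 0
  𝟙-has-not {s} {u} u-not-s = cong 𝟙 (dec-false (shapeAt u ≟ₛ s) u-not-s)

  not-has⇒≢ : ∀ {s u} → not (has s u) ≡ true → shapeAt u ≢ s
  not-has⇒≢ {s} {u} not-s u-s =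
    contradiction (trans (sym not-s) (cong not (dec-true (shapeAt u ≟ₛ s) u-s))) λ ()

  #mono-neighbours #non-mono-neighbours : Fin n → ℕ
  #mono-neighbours     v = countFin (λ u → adj G v u ∧ has mono u)
  #non-mono-neighbours v = countFin (λ u → adj G v u ∧ not (has mono u))

  middle-one-mono-neighbour : ∀ {x y z w} → IsDiamond G x y z w → shapeAt y ≢ mono →
    #mono-neighbours y ≡ 1
  middle-one-mono-neighbour {z = z} d y-not-mono =
    trans (countFin-neighbours (diamond-middle d) (has mono))
          (cong₂ _+_ (𝟙-has-not (diamond-end-not-mono d))
          (cong₂ _+_ (𝟙-has z-mono)
          (cong (_+ 0) (𝟙-has-not (diamond-end-not-mono (diamond-reverse d))))))
    where
    z-mono : shapeAt z ≡ mono
    z-mono = [ (λ y-mono → contradiction y-mono y-not-mono) , id ] (diamond-middle-mono d)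

  between-ends : ∀ {x y z x′ u} → Neighbours x y z x′ → Adj G x u → u ≢ x′ → u ≡ y ⊎ u ≡ z
  between-ends N xu u≢x′ with neighbour-cases N xu
  ... | inj₁ u≡y        = inj₁ u≡y
  ... | inj₂ (inj₁ u≡z) = inj₂ u≡z
  ... | inj₂ (inj₂ u≡x′) = contradiction u≡x′ u≢x′

  -- The neighbours of y are x, z, w, and x′ is neither x nor z.
  end-link-not-mono : ∀ {x y z w x′} → IsDiamond G x y z w → Neighbours x y z x′ → Adj G x′ y →
    shapeAt x′ ≢ mono
  end-link-not-mono d ((_ , _ , z≢x′) , (_ , _ , xx′)) x′y
    with neighbour-cases (diamond-middle d) (Adj-sym x′y)
  ... | inj₁ refl        = contradiction refl (Adj⇒≢ xx′)
  ... | inj₂ (inj₁ refl) = contradiction refl z≢x′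
  ... | inj₂ (inj₂ refl) = diamond-end-not-mono (diamond-reverse d)

  shared-end-not-mono : ∀ {x y z w x′ z₁ w₁} → IsDiamond G x y z w → Neighbours x y z x′ →
    IsDiamond G x x′ z₁ w₁ → shapeAt x′ ≢ mono
  shared-end-not-mono d N (diamond _ _ _ x′≢z₁ _ _ _ xz₁ x′z₁ _ _)
    with between-ends N xz₁ (x′≢z₁ ∘ sym)
  ... | inj₁ refl = end-link-not-mono d N x′z₁
  ... | inj₂ refl = end-link-not-mono (diamond-swap d) (neighbours-swap N) x′z₁

  -- x₁ and w₁ are x's neighbours other than x′, i.e. y and z; as ends of the second diamond
  -- neither is mono, against diamond-middle-mono.
  shared-middle-impossible : ∀ {x y z w x′ x₁ w₁} → IsDiamond G x y z w → Neighbours x y z x′ →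
    ¬ IsDiamond G x₁ x′ x w₁
  shared-middle-impossible {y = y} {z} {x₁ = x₁} {w₁} d N
                           d′@(diamond x₁≢x′ _ x₁≢w₁ _ x′≢w₁ _ _ x₁x _ _ xw₁) =
    [ y-not-mono , z-not-mono ] (diamond-middle-mono d)
    where
    x₁-cases : x₁ ≡ y ⊎ x₁ ≡ z
    x₁-cases = between-ends N (Adj-sym x₁x) x₁≢x′
    w₁-cases : w₁ ≡ y ⊎ w₁ ≡ z
    w₁-cases = between-ends N xw₁ (x′≢w₁ ∘ sym)
    x₁-not-mono : shapeAt x₁ ≢ mono
    x₁-not-mono = diamond-end-not-mono d′
    w₁-not-mono : shapeAt w₁ ≢ mono
    w₁-not-mono = diamond-end-not-mono (diamond-reverse d′)
    y-not-mono : shapeAt y ≢ mono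
    y-not-mono with x₁-cases | w₁-cases
    ... | inj₁ refl | _         = x₁-not-mono
    ... | _         | inj₁ refl = w₁-not-mono
    ... | inj₂ refl | inj₂ refl = contradiction refl x₁≢w₁
    z-not-mono : shapeAt z ≢ mono
    z-not-mono with x₁-cases | w₁-cases
    ... | inj₂ refl | _         = x₁-not-mono
    ... | _         | inj₂ refl = w₁-not-mono
    ... | inj₁ refl | inj₁ refl = contradiction refl x₁≢w₁

  module Census (inDiamond : ∀ v → InDiamond G v) where

    link-not-mono : ∀ {x y z w x′} → IsDiamond G x y z w → Neighbours x y z x′ → shapeAt x′ ≢ mono
    link-not-mono {x} {x′ = x′} d N@(_ , (_ , _ , xx′)) = from-diamond (inDiamond x′)
      where
      x-cases : ∀ {x₁ z₁ w₁} → IsDiamond G x₁ x′ z₁ w₁ → x ≡ x₁ ⊎ x ≡ z₁ ⊎ x ≡ w₁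
      x-cases d′ = neighbour-cases (diamond-middle d′) (Adj-sym xx′)
      as-middle : ∀ {x₁ z₁ w₁} → IsDiamond G x₁ x′ z₁ w₁ → x ≡ x₁ ⊎ x ≡ z₁ ⊎ x ≡ w₁ →
        shapeAt x′ ≢ mono
      as-middle d′ (inj₁ refl)        = shared-end-not-mono d N d′
      as-middle d′ (inj₂ (inj₁ refl)) = contradiction d′ (shared-middle-impossible d N)
      as-middle d′ (inj₂ (inj₂ refl)) = shared-end-not-mono d N (diamond-reverse d′)
      from-diamond : InDiamond G x′ → shapeAt x′ ≢ mono
      from-diamond (_ , _ , _ , _ , d′ , inj₁ refl)               = diamond-end-not-mono d′
      from-diamond (_ , _ , _ , _ , d′ , inj₂ (inj₁ refl))        = as-middle d′ (x-cases d′)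
      from-diamond (_ , _ , _ , _ , d′ , inj₂ (inj₂ (inj₁ refl))) =
        as-middle (diamond-swap d′) (x-cases (diamond-swap d′))
      from-diamond (_ , _ , _ , _ , d′ , inj₂ (inj₂ (inj₂ refl))) =
        diamond-end-not-mono (diamond-reverse d′)

    end-one-mono-neighbour : ∀ {x y z w} → IsDiamond G x y z w → #mono-neighbours x ≡ 1
    end-one-mono-neighbour {x} {y} {z} d@(diamond _ _ _ y≢z _ _ xy xz yz _ _) =
      let x′ , N = third-neighbour y≢z xy xz in begin
      #mono-neighbours x
        ≡⟨ countFin-neighbours N (has mono) ⟩
      𝟙 (has mono y) + (𝟙 (has mono z) + (𝟙 (has mono x′) + 0))
        ≡⟨ cong (λ m → 𝟙 (has mono y) + (𝟙 (has mono z) + (m + 0))) (𝟙-has-not (link-not-mono d N)) ⟩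
      𝟙 (has mono y) + (𝟙 (has mono z) + 0)
        ≡⟨ +-assoc (𝟙 (has mono y)) _ 0 ⟨
      𝟙 (has mono y) + 𝟙 (has mono z) + 0
        ≡⟨ cong (_+ 0) ([ y-mono , z-mono ] (diamond-middle-mono d)) ⟩
      1 ∎
      where
      open ≡-Reasoning
      y-mono : shapeAt y ≡ mono → 𝟙 (has mono y) + 𝟙 (has mono z) ≡ 1
      y-mono y-mono =
        cong₂ _+_ (𝟙-has y-mono) (𝟙-has-not λ z-mono → shapeAt-proper yz (trans y-mono (sym z-mono)))
      z-mono : shapeAt z ≡ mono → 𝟙 (has mono y) + 𝟙 (has mono z) ≡ 1
      z-mono z-mono =
        cong₂ _+_ (𝟙-has-not λ y-mono → shapeAt-proper yz (trans y-mono (sym z-mono))) (𝟙-has z-mono)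

    one-mono-neighbour : ∀ v → shapeAt v ≢ mono → #mono-neighbours v ≡ 1
    one-mono-neighbour v v-not-mono = from-diamond (inDiamond v)
      where
      from-diamond : InDiamond G v → #mono-neighbours v ≡ 1
      from-diamond (_ , _ , _ , _ , d , inj₁ refl)               = end-one-mono-neighbour d
      from-diamond (_ , _ , _ , _ , d , inj₂ (inj₁ refl))        = middle-one-mono-neighbour d v-not-mono
      from-diamond (_ , _ , _ , _ , d , inj₂ (inj₂ (inj₁ refl))) =
        middle-one-mono-neighbour (diamond-swap d) v-not-mono
      from-diamond (_ , _ , _ , _ , d , inj₂ (inj₂ (inj₂ refl))) =
        end-one-mono-neighbour (diamond-reverse d)

    non-mono-neighbours-of-mono : ∀ u → has mono u ≡ true → #non-mono-neighbours u ≡ 3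
    non-mono-neighbours-of-mono u u-mono = begin
      #non-mono-neighbours u                         ≡⟨ countFin-∧-congʳ neighbour-not-mono ⟩
      countFin (λ v → adj G u v ∧ true)              ≡⟨ countFin-cong (∧-identityʳ ∘ adj G u) ⟩
      countFin (adj G u)                             ≡⟨ cubic u ⟩
      3                                              ∎
      where
      open ≡-Reasoning
      neighbour-not-mono : ∀ v → adj G u v ≡ true → not (has mono v) ≡ true
      neighbour-not-mono v uv = cong not (dec-false (shapeAt v ≟ₛ mono) λ v-mono →
        shapeAt-proper uv (trans (dec-true⁻¹ (shapeAt u ≟ₛ mono) u-mono) (sym v-mono)))

    non-mono-neighbours-of-non-mono : ∀ u → shapeAt u ≢ mono → #non-mono-neighbours u ≡ 2
    non-mono-neighbours-of-non-mono u u-not-mono = sym (suc-injective (begin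
      3                                              ≡⟨ cubic u ⟨
      countFin (adj G u)                             ≡⟨ countFin-split (adj G u) (has mono) ⟩
      #mono-neighbours u + #non-mono-neighbours u
        ≡⟨ cong (_+ #non-mono-neighbours u) (one-mono-neighbour u u-not-mono) ⟩
      1 + #non-mono-neighbours u                     ∎))
      where open ≡-Reasoning

    -- A duo vertex has no duo neighbour, so its two non-mono neighbours are rainbow; and vice versa.
    two-neighbours-of-shape : ∀ u s → shapeAt u ≢ mono →
      (∀ v → Adj G u v → has s v ≡ not (has mono v)) → countFin (λ v → adj G u v ∧ has s v) ≡ 2
    two-neighbours-of-shape u s u-not-mono s⇔non-mono =
      trans (countFin-∧-congʳ s⇔non-mono) (non-mono-neighbours-of-non-mono u u-not-mono)

    rainbow-neighbours-of-duo : ∀ u → has duo u ≡ true → countFin (λ v → adj G u v ∧ has rainbow v) ≡ 2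
    rainbow-neighbours-of-duo u has-duo =
      two-neighbours-of-shape u rainbow (λ u-mono → contradiction (trans (sym u-duo) u-mono) λ ())
        λ v uv → rainbow⇔non-mono (shapeAt v) λ v-duo → shapeAt-proper uv (trans u-duo (sym v-duo))
      where
      u-duo : shapeAt u ≡ duo
      u-duo = dec-true⁻¹ (shapeAt u ≟ₛ duo) has-duo

    duo-neighbours-of-rainbow : ∀ u → has rainbow u ≡ true → countFin (λ v → adj G u v ∧ has duo v) ≡ 2
    duo-neighbours-of-rainbow u has-rainbow =
      two-neighbours-of-shape u duo (λ u-mono → contradiction (trans (sym u-rainbow) u-mono) λ ())
        λ v uv → duo⇔non-mono (shapeAt v) λ v-rainbow → shapeAt-proper uv (trans u-rainbow (sym v-rainbow))
      where
      u-rainbow : shapeAt u ≡ rainbow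
      u-rainbow = dec-true⁻¹ (shapeAt u ≟ₛ rainbow) has-rainbow

    #mono #duo #rainbow #non-mono : ℕ
    #mono     = countFin (has mono)
    #duo      = countFin (has duo)
    #rainbow  = countFin (has rainbow)
    #non-mono = countFin (not ∘ has mono)

    3#mono≡#non-mono : 3 * #mono ≡ #non-mono
    3#mono≡#non-mono = trans
      (double-counting (has mono) (not ∘ has mono) non-mono-neighbours-of-mono
         λ v v-not-mono → one-mono-neighbour v (not-has⇒≢ v-not-mono))
      (*-identityˡ #non-mono)

    #duo≡#rainbow : #duo ≡ #rainbow
    #duo≡#rainbow = *-cancelˡ-≡ #duo #rainbow 2
      (double-counting (has duo) (has rainbow) rainbow-neighbours-of-duo duo-neighbours-of-rainbow)

    #non-mono≡#duo+#rainbow : #non-mono ≡ #duo + #rainbow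
    #non-mono≡#duo+#rainbow = trans (countFin-split (not ∘ has mono) (has duo))
      (cong₂ _+_ (countFin-cong (non-mono∧duo ∘ shapeAt)) (countFin-cong (non-mono∧non-duo ∘ shapeAt)))

    #mono+#non-mono≡n : #mono + #non-mono ≡ n
    #mono+#non-mono≡n = trans (sym (countFin-split (λ _ → true) (has mono))) (countFin-true {n})

    3#mono≡#duo+#duo : 3 * #mono ≡ #duo + #duo
    3#mono≡#duo+#duo =
      trans 3#mono≡#non-mono (trans #non-mono≡#duo+#rainbow (cong (#duo +_) (sym #duo≡#rainbow)))

    4#mono≡n : 4 * #mono ≡ n
    4#mono≡n = trans (cong (#mono +_) 3#mono≡#non-mono) #mono+#non-mono≡n

census-not-odd : ∀ {a d t} → 3 * a ≡ d + d → 4 * a ≡ 4 * t → ¬ Odd t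
census-not-odd {a} {d} {t} 3a≡d+d 4a≡4t (m , t≡1+2m) = even≢odd d (suc (3 * m)) (begin
  2 * d                  ≡⟨ cong (d +_) (+-identityʳ d) ⟩
  d + d                  ≡⟨ 3a≡d+d ⟨
  3 * a                  ≡⟨ cong (3 *_) (trans (*-cancelˡ-≡ a t 4 4a≡4t) t≡1+2m) ⟩
  3 * suc (2 * m)        ≡⟨ 3[1+2m]≡1+2[1+3m] m ⟩
  suc (2 * suc (3 * m))  ∎)
  where
  open ≡-Reasoning
  3[1+2m]≡1+2[1+3m] : ∀ m → 3 * suc (2 * m) ≡ suc (2 * suc (3 * m))
  3[1+2m]≡1+2[1+3m] = solve-∀

lemma8 : ∀ {n} (G : Graph n) → OddCycleOfDiamonds G → DalInfinite G
lemma8 G ((cubic , inDiamond) , t , odd-t , n≡4t) k c distinguishing =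
  census-not-odd {#mono} {#duo} 3#mono≡#duo+#duo (trans 4#mono≡n n≡4t) odd-t
  where open Colouring.Census cubic c distinguishing inDiamond
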